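{- (1) If $\mathbf{HLJ}'+(\mathrm{ls})$ derives $\Gamma_1\Rightarrow\Delta_1\mid\cdots\mid\Gamma_n\Rightarrow\Delta_n$, then $\bigvee_{i=1}^{n}(\bigwedge\Gamma_i\to\bigvee\Delta_i)$ is $\mathbf{GD}$-valid. (2) If $\forall\mathbf{HLJ}'+(\forall\text{ - }\mathrm{R_{ms}})+(\mathrm{ls})$ derives $\Gamma_1\Rightarrow\Delta_1\mid\cdots\mid\Gamma_n\Rightarrow\Delta_n$, then the universal closure of $\bigvee_{i=1}^{n}(\bigwedge\Gamma_i\to\bigvee\Delta_i)$ is $\forall\mathbf{GD}$-valid.
   Context: Formulas are built from atoms and $\bot$ with $\land,\lor,\to$ (and, in the predicate case, $\forall,\exists$). A sequent $\Gamma\Rightarrow\Delta$ consists of finite sequences of formulas; a hypersequent is a finite sequence of sequents $\Gamma_1\Rightarrow\Delta_1\mid\cdots\mid\Gamma_n\Rightarrow\Delta_n$; $G,H$ denote possibly empty hypersequents, $S,T$ sequents. An empty conjunction is $\top$, an empty disjunction is $\bot$. $\mathbf{HLK}$ has: axioms $\varphi\Rightarrow\varphi$, $\bot\Rightarrow\varphi$; external weakening (from $G$ infer $S\mid G$), contraction (from $S\mid S\mid G$ infer $S\mid G$), exchange (from $G\mid S\mid T\mid H$ infer $G\mid T\mid S\mid H$); internal weakening, contraction and exchange on either side of a component, with arbitrary side hypersequent $G$; cut: from $\Gamma_0\Rightarrow\Delta_0,\delta\mid G$ and $\delta,\Gamma_1\Rightarrow\Delta_1\mid G$ infer $\Gamma_0,\Gamma_1\Rightarrow\Delta_0,\Delta_1\mid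 G$; logical rules with side hypersequent $G$: from $\varphi_i,\Gamma\Rightarrow\Delta\mid G$ infer $\varphi_1\land\varphi_2,\Gamma\Rightarrow\Delta\mid G$; from $\Gamma\Rightarrow\Delta,\varphi_1\mid G$ and $\Gamma\Rightarrow\Delta,\varphi_2\mid G$ infer $\Gamma\Rightarrow\Delta,\varphi_1\land\varphi_2\mid G$; from $\varphi_1,\Gamma\Rightarrow\Delta\mid G$ and $\varphi_2,\Gamma\Rightarrow\Delta\mid G$ infer $\varphi_1\lor\varphi_2,\Gamma\Rightarrow\Delta\mid G$; from $\Gamma\Rightarrow\Delta,\varphi_i\mid G$ infer $\Gamma\Rightarrow\Delta,\varphi_1\lor\varphi_2\mid G$; from $\Gamma\Rightarrow\Delta,\varphi\mid G$ and $\psi,\Gamma\Rightarrow\Delta\mid G$ infer $\varphi\to\psi,\Gamma\Rightarrow\Delta\mid G$; from $\varphi,\Gamma\Rightarrow\Delta,\psi\mid G$ infer $\Gamma\Rightarrow\Delta,\varphi\to\psi\mid G$. $\mathbf{HLJ}'$ is $\mathbf{HLK}$ with the last rule replaced by: from $\varphi,\Gamma\Rightarrow\psi\mid G$ infer $\Gamma\Rightarrow\varphi\to\psi\mid G$. $\forall\mathbf{HLJ}'$ is $\mathbf{HLJ}'$ plus: from $[t/x]\varphi,\Gamma\Rightarrow\Delta\mid G$ infer $\forall x\varphi,\Gamma\Rightarrow\Delta\mid G$; from $\Gamma\Rightarrow\varphi$ infer $\Gamma\Rightarrow\forall x\varphi$ (single component, $x$ not free in $\Gamma$); from $\varphi,\Gamma\Rightarrow\Delta$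 infer $\exists x\varphi,\Gamma\Rightarrow\Delta$ (single component, $x$ not free in $\Gamma,\Delta$); from $\Gamma\Rightarrow\Delta,[t/x]\psi\mid G$ infer $\Gamma\Rightarrow\Delta,\exists x\psi\mid G$. $(\forall\text{ - }\mathrm{R_{ms}})$: from $\Gamma\Rightarrow\varphi\mid G$ infer $\Gamma\Rightarrow\forall x\varphi\mid G$, $x$ not free in the conclusion. $(\mathrm{ls})$: from $\Gamma_1,\Gamma_2\Rightarrow\Delta\mid G$ infer $\Gamma_1\Rightarrow\Delta\mid\Gamma_2\Rightarrow\Delta\mid G$. $\mathbf{GD}$ is intuitionistic propositional logic plus $\mathsf{LIN}\colon(\varphi\to\psi)\lor(\psi\to\varphi)$; $\forall\mathbf{GD}$ is intuitionistic predicate logic plus $\mathsf{LIN}$ and $\mathsf{ACD}\colon\forall x(\varphi\lor\psi(x))\to\varphi\lor\forall x\psi(x)$ ($x$ not free in $\varphi$). "$L$-valid" means valid (equivalently provable) in $L$. -}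

module Defs where

open import Data.Nat using (ℕ; zero; suc; _⊔_; _∸_)
open import Data.List using (List; []; _∷_; _++_; map; [_])

infix 4 _⇒_
record Seq (A : Set) : Set where
  constructor _⇒_
  field
    ante : List A
    succ : List A
open Seq public

HSeq : Set → Set
HSeq A = List (Seq A)

infixr 8 _∧_
infixr 7 _∨_
infixr 6 _⊃_

data PFm : Set where
  atom : ℕ → PFm
  ⊥    : PFm
  _∧_  : PFm → PFm → PFm
  _∨_  : PFm → PFm → PFm
  _⊃_  : PFm → PFm → PFm

⊤ : PFm
⊤ = ⊥ ⊃ ⊥

⋀ : List PFm → PFm
⋀ []           = ⊤
⋀ (φ ∷ [])     = φ
⋀ (φ ∷ ψ ∷ Γ)  = φ ∧ ⋀ (ψ ∷ Γ)

⋁ : List PFm → PFm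
⋁ []           = ⊥
⋁ (φ ∷ [])     = φ
⋁ (φ ∷ ψ ∷ Γ)  = φ ∨ ⋁ (ψ ∷ Γ)

interp : HSeq PFm → PFm
interp H = ⋁ (map (λ S → ⋀ (ante S) ⊃ ⋁ (succ S)) H)

data HLJ'ls : HSeq PFm → Set where
  ax    : ∀ {φ} → HLJ'ls ((φ ∷ [] ⇒ φ ∷ []) ∷ [])
  ax⊥   : ∀ {φ} → HLJ'ls ((⊥ ∷ [] ⇒ φ ∷ []) ∷ [])
  ew    : ∀ {S G} → HLJ'ls G → HLJ'ls (S ∷ G)
  ec    : ∀ {S G} → HLJ'ls (S ∷ S ∷ G) → HLJ'ls (S ∷ G)
  ee    : ∀ {G S T H} → HLJ'ls (G ++ S ∷ T ∷ H) → HLJ'ls (G ++ T ∷ S ∷ H)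
  iwl   : ∀ {φ Γ Δ G} → HLJ'ls ((Γ ⇒ Δ) ∷ G) → HLJ'ls ((φ ∷ Γ ⇒ Δ) ∷ G)
  iwr   : ∀ {φ Γ Δ G} → HLJ'ls ((Γ ⇒ Δ) ∷ G) → HLJ'ls ((Γ ⇒ Δ ++ [ φ ]) ∷ G)
  icl   : ∀ {φ Γ Δ G} → HLJ'ls ((φ ∷ φ ∷ Γ ⇒ Δ) ∷ G) → HLJ'ls ((φ ∷ Γ ⇒ Δ) ∷ G)
  icr   : ∀ {φ Γ Δ G} → HLJ'ls ((Γ ⇒ Δ ++ φ ∷ φ ∷ []) ∷ G) → HLJ'ls ((Γ ⇒ Δ ++ [ φ ]) ∷ G)
  iel   : ∀ {φ ψ Γ Γ' Δ G} → HLJ'ls ((Γ ++ φ ∷ ψ ∷ Γ' ⇒ Δ) ∷ G) → HLJ'ls ((Γ ++ ψ ∷ φ ∷ Γ' ⇒ Δ) ∷ G)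
  ier   : ∀ {φ ψ Γ Δ Δ' G} → HLJ'ls ((Γ ⇒ Δ ++ φ ∷ ψ ∷ Δ') ∷ G) → HLJ'ls ((Γ ⇒ Δ ++ ψ ∷ φ ∷ Δ') ∷ G)
  cut   : ∀ {δ Γ₀ Γ₁ Δ₀ Δ₁ G} →
          HLJ'ls ((Γ₀ ⇒ Δ₀ ++ [ δ ]) ∷ G) → HLJ'ls ((δ ∷ Γ₁ ⇒ Δ₁) ∷ G) →
          HLJ'ls ((Γ₀ ++ Γ₁ ⇒ Δ₀ ++ Δ₁) ∷ G)
  ∧L₁   : ∀ {φ₁ φ₂ Γ Δ G} → HLJ'ls ((φ₁ ∷ Γ ⇒ Δ) ∷ G) → HLJ'ls ((φ₁ ∧ φ₂ ∷ Γ ⇒ Δ) ∷ G)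
  ∧L₂   : ∀ {φ₁ φ₂ Γ Δ G} → HLJ'ls ((φ₂ ∷ Γ ⇒ Δ) ∷ G) → HLJ'ls ((φ₁ ∧ φ₂ ∷ Γ ⇒ Δ) ∷ G)
  ∧R    : ∀ {φ₁ φ₂ Γ Δ G} → HLJ'ls ((Γ ⇒ Δ ++ [ φ₁ ]) ∷ G) → HLJ'ls ((Γ ⇒ Δ ++ [ φ₂ ]) ∷ G) →
          HLJ'ls ((Γ ⇒ Δ ++ [ φ₁ ∧ φ₂ ]) ∷ G)
  ∨L    : ∀ {φ₁ φ₂ Γ Δ G} → HLJ'ls ((φ₁ ∷ Γ ⇒ Δ) ∷ G) → HLJ'ls ((φ₂ ∷ Γ ⇒ Δ) ∷ G) →
          HLJ'ls ((φ₁ ∨ φ₂ ∷ Γ ⇒ Δ) ∷ G)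
  ∨R₁   : ∀ {φ₁ φ₂ Γ Δ G} → HLJ'ls ((Γ ⇒ Δ ++ [ φ₁ ]) ∷ G) → HLJ'ls ((Γ ⇒ Δ ++ [ φ₁ ∨ φ₂ ]) ∷ G)
  ∨R₂   : ∀ {φ₁ φ₂ Γ Δ G} → HLJ'ls ((Γ ⇒ Δ ++ [ φ₂ ]) ∷ G) → HLJ'ls ((Γ ⇒ Δ ++ [ φ₁ ∨ φ₂ ]) ∷ G)
  ⊃L    : ∀ {φ ψ Γ Δ G} → HLJ'ls ((Γ ⇒ Δ ++ [ φ ]) ∷ G) → HLJ'ls ((ψ ∷ Γ ⇒ Δ) ∷ G) →
          HLJ'ls ((φ ⊃ ψ ∷ Γ ⇒ Δ) ∷ G)
  ⊃R'   : ∀ {φ ψ Γ G} → HLJ'ls ((φ ∷ Γ ⇒ [ ψ ]) ∷ G) → HLJ'ls ((Γ ⇒ [ φ ⊃ ψ ]) ∷ G)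
  ls    : ∀ {Γ₁ Γ₂ Δ G} → HLJ'ls ((Γ₁ ++ Γ₂ ⇒ Δ) ∷ G) → HLJ'ls ((Γ₁ ⇒ Δ) ∷ (Γ₂ ⇒ Δ) ∷ G)

-- GD: natural deduction for intuitionistic propositional logic + LIN
infix 3 _⊢GD_
data _⊢GD_ : List PFm → PFm → Set where
  hyp  : ∀ {Γ Γ' φ} → Γ ++ φ ∷ Γ' ⊢GD φ
  ⊥E   : ∀ {Γ φ} → Γ ⊢GD ⊥ → Γ ⊢GD φ
  ∧I   : ∀ {Γ φ ψ} → Γ ⊢GD φ → Γ ⊢GD ψ → Γ ⊢GD φ ∧ ψ
  ∧E₁  : ∀ {Γ φ ψ} → Γ ⊢GD φ ∧ ψ → Γ ⊢GD φ
  ∧E₂  : ∀ {Γ φ ψ} → Γ ⊢GD φ ∧ ψ → Γ ⊢GD ψ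
  ∨I₁  : ∀ {Γ φ ψ} → Γ ⊢GD φ → Γ ⊢GD φ ∨ ψ
  ∨I₂  : ∀ {Γ φ ψ} → Γ ⊢GD ψ → Γ ⊢GD φ ∨ ψ
  ∨E   : ∀ {Γ φ ψ χ} → Γ ⊢GD φ ∨ ψ → φ ∷ Γ ⊢GD χ → ψ ∷ Γ ⊢GD χ → Γ ⊢GD χ
  ⊃I   : ∀ {Γ φ ψ} → φ ∷ Γ ⊢GD ψ → Γ ⊢GD φ ⊃ ψ
  ⊃E   : ∀ {Γ φ ψ} → Γ ⊢GD φ ⊃ ψ → Γ ⊢GD φ → Γ ⊢GD ψ
  lin  : ∀ {Γ φ ψ} → Γ ⊢GD (φ ⊃ ψ) ∨ (ψ ⊃ φ)

GD-valid : PFm → Set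
GD-valid φ = [] ⊢GD φ

data Term : Set where
  var : ℕ → Term
  fn  : ℕ → List Term → Term

data Fm : Set where
  atom : ℕ → List Term → Fm
  ⊥    : Fm
  _∧_  : Fm → Fm → Fm
  _∨_  : Fm → Fm → Fm
  _⊃_  : Fm → Fm → Fm
  ∀̇    : Fm → Fm    -- ∀̇ φ binds de Bruijn index 0 in φ
  ∃̇    : Fm → Fm

liftR : (ℕ → ℕ) → ℕ → ℕ
liftR ρ zero    = zero
liftR ρ (suc n) = suc (ρ n)

mutual
  renT : (ℕ → ℕ) → Term → Term
  renT ρ (var n)   = var (ρ n)
  renT ρ (fn f ts) = fn f (renTs ρ ts)

  renTs : (ℕ → ℕ) → List Term → List Term
  renTs ρ []       = []
  renTs ρ (t ∷ ts) = renT ρ t ∷ renTs ρ ts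

ren : (ℕ → ℕ) → Fm → Fm
ren ρ (atom p ts) = atom p (renTs ρ ts)
ren ρ ⊥           = ⊥
ren ρ (φ ∧ ψ)     = ren ρ φ ∧ ren ρ ψ
ren ρ (φ ∨ ψ)     = ren ρ φ ∨ ren ρ ψ
ren ρ (φ ⊃ ψ)     = ren ρ φ ⊃ ren ρ ψ
ren ρ (∀̇ φ)       = ∀̇ (ren (liftR ρ) φ)
ren ρ (∃̇ φ)       = ∃̇ (ren (liftR ρ) φ)

-- shift: make room for a fresh variable (index 0) not occurring in the formula
↑ : Fm → Fm
↑ = ren suc

↑* : List Fm → List Fm
↑* = map ↑

↑S : Seq Fm → Seq Fm
↑S (Γ ⇒ Δ) = ↑* Γ ⇒ ↑* Δ

↑H : HSeq Fm → HSeq Fm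
↑H = map ↑S

liftS : (ℕ → Term) → ℕ → Term
liftS σ zero    = var zero
liftS σ (suc n) = renT suc (σ n)

mutual
  subT : (ℕ → Term) → Term → Term
  subT σ (var n)   = σ n
  subT σ (fn f ts) = fn f (subTs σ ts)

  subTs : (ℕ → Term) → List Term → List Term
  subTs σ []       = []
  subTs σ (t ∷ ts) = subT σ t ∷ subTs σ ts

sub : (ℕ → Term) → Fm → Fm
sub σ (atom p ts) = atom p (subTs σ ts)
sub σ ⊥           = ⊥
sub σ (φ ∧ ψ)     = sub σ φ ∧ sub σ ψ
sub σ (φ ∨ ψ)     = sub σ φ ∨ sub σ ψ
sub σ (φ ⊃ ψ)     = sub σ φ ⊃ sub σ ψ
sub σ (∀̇ φ)       = ∀̇ (sub (liftS σ) φ)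
sub σ (∃̇ φ)       = ∃̇ (sub (liftS σ) φ)

inst₀ : Term → ℕ → Term
inst₀ t zero    = t
inst₀ t (suc n) = var n

_⟨_⟩ : Fm → Term → Fm
φ ⟨ t ⟩ = sub (inst₀ t) φ

-- number of free variables: least k such that all free indices are < k
mutual
  fvT : Term → ℕ
  fvT (var n)   = suc n
  fvT (fn f ts) = fvTs ts

  fvTs : List Term → ℕ
  fvTs []       = 0
  fvTs (t ∷ ts) = fvT t ⊔ fvTs ts

fv : Fm → ℕ
fv (atom p ts) = fvTs ts
fv ⊥           = 0
fv (φ ∧ ψ)     = fv φ ⊔ fv ψ
fv (φ ∨ ψ)     = fv φ ⊔ fv ψ
fv (φ ⊃ ψ)     = fv φ ⊔ fv ψ
fv (∀̇ φ)       = fv φ ∸ 1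
fv (∃̇ φ)       = fv φ ∸ 1

∀ⁿ : ℕ → Fm → Fm
∀ⁿ zero    φ = φ
∀ⁿ (suc k) φ = ∀̇ (∀ⁿ k φ)

closure : Fm → Fm
closure φ = ∀ⁿ (fv φ) φ

⊤F : Fm
⊤F = ⊥ ⊃ ⊥

⋀F : List Fm → Fm
⋀F []           = ⊤F
⋀F (φ ∷ [])     = φ
⋀F (φ ∷ ψ ∷ Γ)  = φ ∧ ⋀F (ψ ∷ Γ)

⋁F : List Fm → Fm
⋁F []           = ⊥
⋁F (φ ∷ [])     = φ
⋁F (φ ∷ ψ ∷ Γ)  = φ ∨ ⋁F (ψ ∷ Γ)

interpF : HSeq Fm → Fm
interpF H = ⋁F (map (λ S → ⋀F (ante S) ⊃ ⋁F (succ S)) H)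

data ∀HLJ'ms : HSeq Fm → Set where
  ax    : ∀ {φ} → ∀HLJ'ms ((φ ∷ [] ⇒ φ ∷ []) ∷ [])
  ax⊥   : ∀ {φ} → ∀HLJ'ms ((⊥ ∷ [] ⇒ φ ∷ []) ∷ [])
  ew    : ∀ {S G} → ∀HLJ'ms G → ∀HLJ'ms (S ∷ G)
  ec    : ∀ {S G} → ∀HLJ'ms (S ∷ S ∷ G) → ∀HLJ'ms (S ∷ G)
  ee    : ∀ {G S T H} → ∀HLJ'ms (G ++ S ∷ T ∷ H) → ∀HLJ'ms (G ++ T ∷ S ∷ H)
  iwl   : ∀ {φ Γ Δ G} → ∀HLJ'ms ((Γ ⇒ Δ) ∷ G) → ∀HLJ'ms ((φ ∷ Γ ⇒ Δ) ∷ G)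
  iwr   : ∀ {φ Γ Δ G} → ∀HLJ'ms ((Γ ⇒ Δ) ∷ G) → ∀HLJ'ms ((Γ ⇒ Δ ++ [ φ ]) ∷ G)
  icl   : ∀ {φ Γ Δ G} → ∀HLJ'ms ((φ ∷ φ ∷ Γ ⇒ Δ) ∷ G) → ∀HLJ'ms ((φ ∷ Γ ⇒ Δ) ∷ G)
  icr   : ∀ {φ Γ Δ G} → ∀HLJ'ms ((Γ ⇒ Δ ++ φ ∷ φ ∷ []) ∷ G) → ∀HLJ'ms ((Γ ⇒ Δ ++ [ φ ]) ∷ G)
  iel   : ∀ {φ ψ Γ Γ' Δ G} → ∀HLJ'ms ((Γ ++ φ ∷ ψ ∷ Γ' ⇒ Δ) ∷ G) → ∀HLJ'ms ((Γ ++ ψ ∷ φ ∷ Γ' ⇒ Δ) ∷ G)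
  ier   : ∀ {φ ψ Γ Δ Δ' G} → ∀HLJ'ms ((Γ ⇒ Δ ++ φ ∷ ψ ∷ Δ') ∷ G) → ∀HLJ'ms ((Γ ⇒ Δ ++ ψ ∷ φ ∷ Δ') ∷ G)
  cut   : ∀ {δ Γ₀ Γ₁ Δ₀ Δ₁ G} →
          ∀HLJ'ms ((Γ₀ ⇒ Δ₀ ++ [ δ ]) ∷ G) → ∀HLJ'ms ((δ ∷ Γ₁ ⇒ Δ₁) ∷ G) →
          ∀HLJ'ms ((Γ₀ ++ Γ₁ ⇒ Δ₀ ++ Δ₁) ∷ G)
  ∧L₁   : ∀ {φ₁ φ₂ Γ Δ G} → ∀HLJ'ms ((φ₁ ∷ Γ ⇒ Δ) ∷ G) → ∀HLJ'ms ((φ₁ ∧ φ₂ ∷ Γ ⇒ Δ) ∷ G)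
  ∧L₂   : ∀ {φ₁ φ₂ Γ Δ G} → ∀HLJ'ms ((φ₂ ∷ Γ ⇒ Δ) ∷ G) → ∀HLJ'ms ((φ₁ ∧ φ₂ ∷ Γ ⇒ Δ) ∷ G)
  ∧R    : ∀ {φ₁ φ₂ Γ Δ G} → ∀HLJ'ms ((Γ ⇒ Δ ++ [ φ₁ ]) ∷ G) → ∀HLJ'ms ((Γ ⇒ Δ ++ [ φ₂ ]) ∷ G) →
          ∀HLJ'ms ((Γ ⇒ Δ ++ [ φ₁ ∧ φ₂ ]) ∷ G)
  ∨L    : ∀ {φ₁ φ₂ Γ Δ G} → ∀HLJ'ms ((φ₁ ∷ Γ ⇒ Δ) ∷ G) → ∀HLJ'ms ((φ₂ ∷ Γ ⇒ Δ) ∷ G) →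
          ∀HLJ'ms ((φ₁ ∨ φ₂ ∷ Γ ⇒ Δ) ∷ G)
  ∨R₁   : ∀ {φ₁ φ₂ Γ Δ G} → ∀HLJ'ms ((Γ ⇒ Δ ++ [ φ₁ ]) ∷ G) → ∀HLJ'ms ((Γ ⇒ Δ ++ [ φ₁ ∨ φ₂ ]) ∷ G)
  ∨R₂   : ∀ {φ₁ φ₂ Γ Δ G} → ∀HLJ'ms ((Γ ⇒ Δ ++ [ φ₂ ]) ∷ G) → ∀HLJ'ms ((Γ ⇒ Δ ++ [ φ₁ ∨ φ₂ ]) ∷ G)
  ⊃L    : ∀ {φ ψ Γ Δ G} → ∀HLJ'ms ((Γ ⇒ Δ ++ [ φ ]) ∷ G) → ∀HLJ'ms ((ψ ∷ Γ ⇒ Δ) ∷ G) →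
          ∀HLJ'ms ((φ ⊃ ψ ∷ Γ ⇒ Δ) ∷ G)
  ⊃R'   : ∀ {φ ψ Γ G} → ∀HLJ'ms ((φ ∷ Γ ⇒ [ ψ ]) ∷ G) → ∀HLJ'ms ((Γ ⇒ [ φ ⊃ ψ ]) ∷ G)
  ∀L    : ∀ {φ t Γ Δ G} → ∀HLJ'ms ((φ ⟨ t ⟩ ∷ Γ ⇒ Δ) ∷ G) → ∀HLJ'ms ((∀̇ φ ∷ Γ ⇒ Δ) ∷ G)
  ∀R    : ∀ {φ Γ} → ∀HLJ'ms ((↑* Γ ⇒ [ φ ]) ∷ []) → ∀HLJ'ms ((Γ ⇒ [ ∀̇ φ ]) ∷ [])
  ∃L    : ∀ {φ Γ Δ} → ∀HLJ'ms ((φ ∷ ↑* Γ ⇒ ↑* Δ) ∷ []) → ∀HLJ'ms ((∃̇ φ ∷ Γ ⇒ Δ) ∷ [])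
  ∃R    : ∀ {φ t Γ Δ G} → ∀HLJ'ms ((Γ ⇒ Δ ++ [ φ ⟨ t ⟩ ]) ∷ G) → ∀HLJ'ms ((Γ ⇒ Δ ++ [ ∃̇ φ ]) ∷ G)
  ∀Rms  : ∀ {φ Γ G} → ∀HLJ'ms ((↑* Γ ⇒ [ φ ]) ∷ ↑H G) → ∀HLJ'ms ((Γ ⇒ [ ∀̇ φ ]) ∷ G)
  ls    : ∀ {Γ₁ Γ₂ Δ G} → ∀HLJ'ms ((Γ₁ ++ Γ₂ ⇒ Δ) ∷ G) → ∀HLJ'ms ((Γ₁ ⇒ Δ) ∷ (Γ₂ ⇒ Δ) ∷ G)

-- ∀GD: natural deduction for intuitionistic predicate logic + LIN + ACD
infix 3 _⊢∀GD_
data _⊢∀GD_ : List Fm → Fm → Set where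
  hyp  : ∀ {Γ Γ' φ} → Γ ++ φ ∷ Γ' ⊢∀GD φ
  ⊥E   : ∀ {Γ φ} → Γ ⊢∀GD ⊥ → Γ ⊢∀GD φ
  ∧I   : ∀ {Γ φ ψ} → Γ ⊢∀GD φ → Γ ⊢∀GD ψ → Γ ⊢∀GD φ ∧ ψ
  ∧E₁  : ∀ {Γ φ ψ} → Γ ⊢∀GD φ ∧ ψ → Γ ⊢∀GD φ
  ∧E₂  : ∀ {Γ φ ψ} → Γ ⊢∀GD φ ∧ ψ → Γ ⊢∀GD ψ
  ∨I₁  : ∀ {Γ φ ψ} → Γ ⊢∀GD φ → Γ ⊢∀GD φ ∨ ψ
  ∨I₂  : ∀ {Γ φ ψ} → Γ ⊢∀GD ψ → Γ ⊢∀GD φ ∨ ψ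
  ∨E   : ∀ {Γ φ ψ χ} → Γ ⊢∀GD φ ∨ ψ → φ ∷ Γ ⊢∀GD χ → ψ ∷ Γ ⊢∀GD χ → Γ ⊢∀GD χ
  ⊃I   : ∀ {Γ φ ψ} → φ ∷ Γ ⊢∀GD ψ → Γ ⊢∀GD φ ⊃ ψ
  ⊃E   : ∀ {Γ φ ψ} → Γ ⊢∀GD φ ⊃ ψ → Γ ⊢∀GD φ → Γ ⊢∀GD ψ
  ∀I   : ∀ {Γ φ} → ↑* Γ ⊢∀GD φ → Γ ⊢∀GD ∀̇ φ
  ∀E   : ∀ {Γ φ} (t : Term) → Γ ⊢∀GD ∀̇ φ → Γ ⊢∀GD φ ⟨ t ⟩
  ∃I   : ∀ {Γ φ} (t : Term) → Γ ⊢∀GD φ ⟨ t ⟩ → Γ ⊢∀GD ∃̇ φ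
  ∃E   : ∀ {Γ φ χ} → Γ ⊢∀GD ∃̇ φ → φ ∷ ↑* Γ ⊢∀GD ↑ χ → Γ ⊢∀GD χ
  lin  : ∀ {Γ φ ψ} → Γ ⊢∀GD (φ ⊃ ψ) ∨ (ψ ⊃ φ)
  -- ACD: ∀x(φ ∨ ψ(x)) → φ ∨ ∀x ψ(x), x not free in φ (ensured by ↑)
  acd  : ∀ {Γ φ ψ} → Γ ⊢∀GD ∀̇ (↑ φ ∨ ψ) ⊃ (φ ∨ ∀̇ ψ)

∀GD-valid : Fm → Set
∀GD-valid φ = [] ⊢∀GD φ

-- Read a hypersequent S₁ | … | Sₙ as the disjunction ⟦S₁⟧ ∨ … ∨ ⟦Sₙ⟧ and show that every rule
-- preserves derivability of that disjunction.  Rules acting on one component with a side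
-- hypersequent G are sound as soon as the component-wise step is intuitionistically valid in
-- every context: a case split on ⟦S⟧ ∨ ⟦G⟧ either feeds ⟦S⟧ into it or keeps the disjunct ⟦G⟧.
-- Only two rules need more than intuitionistic logic.  (ls) splits Γ₁, Γ₂ ⇒ Δ into
-- Γ₁ ⇒ Δ | Γ₂ ⇒ Δ: by LIN one of ⋀Γ₁, ⋀Γ₂ implies the other, so the component with the
-- stronger antecedent already yields all of Γ₁, Γ₂.  (∀-R_ms) generalises a component in the
-- presence of a side hypersequent G in which the eigenvariable is not free: from
-- ∀x(⟦G⟧ ∨ (⋀Γ → φ)) the axiom ACD moves ⟦G⟧ out of the quantifier.

module Submission where

open import Defs using (Seq; _⇒_; HSeq)
open import Data.Nat using (ℕ; zero; suc)
open import Data.Product using (_×_; _,_)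
open import Data.Sum using (_⊎_; inj₁; inj₂)
open import Function using (_∘_)
open import Data.List using (List; []; _∷_; _++_; map; [_])
open import Data.List.Membership.Propositional using (_∈_)
open import Data.List.Membership.Propositional.Properties using (∈-++⁺ˡ; ∈-++⁺ʳ; ∈-++⁻; ∈-∃++; ∈-insert)
open import Data.List.Relation.Unary.Any using (here; there)
open import Data.List.Relation.Unary.All using (All; []; _∷_)
import Data.List.Relation.Unary.All as All
import Data.List.Relation.Unary.All.Properties as All
open import Data.List.Relation.Binary.Subset.Propositional using (_⊆_)
open import Data.List.Relation.Binary.Subset.Propositional.Properties
  using (⊆-refl; ⊆-reflexive-↭; All-resp-⊇; map⁺; ∷⁺ʳ; ∈-∷⁺ʳ; ++⁺ʳ; xs⊆ys++xs)
open import Data.List.Relation.Binary.Permutation.Propositional using (refl; swap)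
import Data.List.Relation.Binary.Permutation.Propositional.Properties as Perm
open import Relation.Binary.PropositionalEquality using (_≡_; refl; sym; cong; cong₂; subst; module ≡-Reasoning)

∷∷⊆∷ : ∀ {A : Set} {x : A} {xs} → x ∷ x ∷ xs ⊆ x ∷ xs
∷∷⊆∷ = ∈-∷⁺ʳ (here refl) ⊆-refl

swap⊆ : ∀ {A : Set} (xs : List A) {x y ys} → xs ++ x ∷ y ∷ ys ⊆ xs ++ y ∷ x ∷ ys
swap⊆ xs {x} {y} = ⊆-reflexive-↭ (Perm.++⁺ˡ xs (swap x y refl))

-- ⋀ and ⋁ are fields constrained by their defining equations, rather than defined here, so that
-- the list connectives of both languages instantiate them definitionally.
record GödelDummettCalculus : Set₁ where
  infixr 8 _∧_
  infixr 7 _∨_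
  infixr 6 _⊃_
  infix 3 _⊢_
  field
    Formula      : Set
    ⊥            : Formula
    _∧_ _∨_ _⊃_  : Formula → Formula → Formula
    ⋀ ⋁          : List Formula → Formula
    ⋀-nil        : ⋀ [] ≡ ⊥ ⊃ ⊥
    ⋀-singleton  : ∀ φ → ⋀ [ φ ] ≡ φ
    ⋀-cons       : ∀ φ ψ Γ → ⋀ (φ ∷ ψ ∷ Γ) ≡ φ ∧ ⋀ (ψ ∷ Γ)
    ⋁-nil        : ⋁ [] ≡ ⊥
    ⋁-singleton  : ∀ φ → ⋁ [ φ ] ≡ φ
    ⋁-cons       : ∀ φ ψ Δ → ⋁ (φ ∷ ψ ∷ Δ) ≡ φ ∨ ⋁ (ψ ∷ Δ)
    _⊢_          : List Formula → Formula → Set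
    weaken       : ∀ {Θ Θ' φ} → Θ ⊆ Θ' → Θ ⊢ φ → Θ' ⊢ φ
    assumption   : ∀ {Θ φ} → φ ∈ Θ → Θ ⊢ φ
    ⊥E           : ∀ {Θ φ} → Θ ⊢ ⊥ → Θ ⊢ φ
    ∧I           : ∀ {Θ φ ψ} → Θ ⊢ φ → Θ ⊢ ψ → Θ ⊢ φ ∧ ψ
    ∧E₁          : ∀ {Θ φ ψ} → Θ ⊢ φ ∧ ψ → Θ ⊢ φ
    ∧E₂          : ∀ {Θ φ ψ} → Θ ⊢ φ ∧ ψ → Θ ⊢ ψ
    ∨I₁          : ∀ {Θ φ ψ} → Θ ⊢ φ → Θ ⊢ φ ∨ ψ
    ∨I₂          : ∀ {Θ φ ψ} → Θ ⊢ ψ → Θ ⊢ φ ∨ ψ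
    ∨E           : ∀ {Θ φ ψ χ} → Θ ⊢ φ ∨ ψ → φ ∷ Θ ⊢ χ → ψ ∷ Θ ⊢ χ → Θ ⊢ χ
    ⊃I           : ∀ {Θ φ ψ} → φ ∷ Θ ⊢ ψ → Θ ⊢ φ ⊃ ψ
    ⊃E           : ∀ {Θ φ ψ} → Θ ⊢ φ ⊃ ψ → Θ ⊢ φ → Θ ⊢ ψ
    lin          : ∀ {Θ φ ψ} → Θ ⊢ (φ ⊃ ψ) ∨ (ψ ⊃ φ)

module Soundness (L : GödelDummettCalculus) where
  open GödelDummettCalculus L

  private
    variable
      Θ Θ' Γ Γ' Γ₁ Γ₂ Δ Δ' : List Formula
      φ ψ χ δ : Formula
      S S₁ S₂ T : Seq Formula
      G H H' : HSeq Formula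

  hyp₀ : φ ∷ Θ ⊢ φ
  hyp₀ = assumption (here refl)

  hyp₁ : ψ ∷ φ ∷ Θ ⊢ φ
  hyp₁ = assumption (there (here refl))

  All-assume : All (Θ ⊢_) Γ → All (φ ∷ Θ ⊢_) (φ ∷ Γ)
  All-assume ps = hyp₀ ∷ All.map (weaken there) ps

  ⋀-intro : ∀ Γ → All (Θ ⊢_) Γ → Θ ⊢ ⋀ Γ
  ⋀-intro []          []       = subst (_ ⊢_) (sym ⋀-nil) (⊃I hyp₀)
  ⋀-intro (φ ∷ [])    (p ∷ []) = subst (_ ⊢_) (sym (⋀-singleton φ)) p
  ⋀-intro (φ ∷ ψ ∷ Γ) (p ∷ ps) = subst (_ ⊢_) (sym (⋀-cons φ ψ Γ)) (∧I p (⋀-intro (ψ ∷ Γ) ps))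

  ⋀-elim : ∀ Γ → Θ ⊢ ⋀ Γ → All (Θ ⊢_) Γ
  ⋀-elim []          p = []
  ⋀-elim (φ ∷ [])    p = subst (_ ⊢_) (⋀-singleton φ) p ∷ []
  ⋀-elim (φ ∷ ψ ∷ Γ) p = ∧E₁ p′ ∷ ⋀-elim (ψ ∷ Γ) (∧E₂ p′)
    where p′ = subst (_ ⊢_) (⋀-cons φ ψ Γ) p

  ⋁-intro : ∀ Δ → φ ∈ Δ → Θ ⊢ φ → Θ ⊢ ⋁ Δ
  ⋁-intro (δ ∷ [])    (here refl) p = subst (_ ⊢_) (sym (⋁-singleton δ)) p
  ⋁-intro (δ ∷ ψ ∷ Δ) (here refl) p = subst (_ ⊢_) (sym (⋁-cons δ ψ Δ)) (∨I₁ p)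
  ⋁-intro (δ ∷ ψ ∷ Δ) (there m)   p = subst (_ ⊢_) (sym (⋁-cons δ ψ Δ)) (∨I₂ (⋁-intro (ψ ∷ Δ) m p))

  ⋁-hyp : δ ∈ Δ → δ ∷ Θ ⊢ ⋁ Δ
  ⋁-hyp m = ⋁-intro _ m hyp₀

  ⋁-elim : ∀ Δ → Θ ⊢ ⋁ Δ → (∀ {δ} → δ ∈ Δ → δ ∷ Θ ⊢ χ) → Θ ⊢ χ
  ⋁-elim []          p k = ⊥E (subst (_ ⊢_) ⋁-nil p)
  ⋁-elim (δ ∷ [])    p k = ⊃E (⊃I (k (here refl))) (subst (_ ⊢_) (⋁-singleton δ) p)
  ⋁-elim (δ ∷ ψ ∷ Δ) p k = ∨E (subst (_ ⊢_) (⋁-cons δ ψ Δ) p) (k (here refl))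
    (⋁-elim (ψ ∷ Δ) hyp₀ (λ m → weaken (∷⁺ʳ _ there) (k (there m))))

  ⋁-mono : Δ ⊆ Δ' → Θ ⊢ ⋁ Δ → Θ ⊢ ⋁ Δ'
  ⋁-mono s p = ⋁-elim _ p (λ m → ⋁-hyp (s m))

  ⋁-∷⁺ : Θ ⊢ φ ∨ ⋁ Δ → Θ ⊢ ⋁ (φ ∷ Δ)
  ⋁-∷⁺ p = ∨E p (⋁-hyp (here refl)) (⋁-mono there hyp₀)

  ⋁-∷⁻ : Θ ⊢ ⋁ (φ ∷ Δ) → Θ ⊢ φ ∨ ⋁ Δ
  ⋁-∷⁻ p = ⋁-elim _ p λ { (here refl) → ∨I₁ hyp₀ ; (there m) → ∨I₂ (⋁-hyp m) }

  ⋁-++-[]-elim : Θ ⊢ ⋁ (Δ ++ [ φ ]) → (∀ {δ} → δ ∈ Δ → δ ∷ Θ ⊢ χ) → φ ∷ Θ ⊢ χ → Θ ⊢ χ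
  ⋁-++-[]-elim {Δ = Δ} p k k′ = ⋁-elim (Δ ++ _) p λ m → split (∈-++⁻ Δ m)
    where
    split : ∀ {δ} → δ ∈ Δ ⊎ δ ∈ [ _ ] → δ ∷ _ ⊢ _
    split (inj₁ m)           = k m
    split (inj₂ (here refl)) = k′

  ⟦_⟧ˢ : Seq Formula → Formula
  ⟦ Γ ⇒ Δ ⟧ˢ = ⋀ Γ ⊃ ⋁ Δ

  ⟦_⟧ʰ : HSeq Formula → Formula
  ⟦ H ⟧ʰ = ⋁ (map ⟦_⟧ˢ H)

  infix 3 _⊢ˢ_ ⊢ʰ_

  record _⊢ˢ_ (Θ : List Formula) (S : Seq Formula) : Set where
    constructor sequent
    field derivationˢ : Θ ⊢ ⟦ S ⟧ˢ

  record ⊢ʰ_ (H : HSeq Formula) : Set where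
    constructor hypersequent
    field derivationʰ : [] ⊢ ⟦ H ⟧ʰ

  open _⊢ˢ_ public
  open ⊢ʰ_ public

  ⊢ˢ-intro : (∀ {Θ'} → Θ ⊆ Θ' → All (Θ' ⊢_) Γ → Θ' ⊢ ⋁ Δ) → Θ ⊢ˢ Γ ⇒ Δ
  ⊢ˢ-intro {Γ = Γ} k = sequent (⊃I (k there (⋀-elim Γ hyp₀)))

  ⊢ˢ-weaken : Θ ⊆ Θ' → Θ ⊢ˢ S → Θ' ⊢ˢ S
  ⊢ˢ-weaken s (sequent p) = sequent (weaken s p)

  ⊢ˢ-apply : Θ ⊢ˢ Γ ⇒ Δ → ∀ {Θ'} → Θ ⊆ Θ' → All (Θ' ⊢_) Γ → Θ' ⊢ ⋁ Δ
  ⊢ˢ-apply {Γ = Γ} (sequent p) s ps = ⊃E (weaken s p) (⋀-intro Γ ps)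

  ⊢ˢ-antecedent : (∀ {Θ'} → All (Θ' ⊢_) Γ → All (Θ' ⊢_) Γ') → Θ ⊢ˢ Γ' ⇒ Δ → Θ ⊢ˢ Γ ⇒ Δ
  ⊢ˢ-antecedent f p = ⊢ˢ-intro λ s ps → ⊢ˢ-apply p s (f ps)

  ⊢ˢ-succedent : (∀ {Θ'} → Θ' ⊢ ⋁ Δ → Θ' ⊢ ⋁ Δ') → Θ ⊢ˢ Γ ⇒ Δ → Θ ⊢ˢ Γ ⇒ Δ'
  ⊢ˢ-succedent f p = ⊢ˢ-intro λ s ps → f (⊢ˢ-apply p s ps)

  ⊢ˢ-monoˡ : Γ ⊆ Γ' → Θ ⊢ˢ Γ ⇒ Δ → Θ ⊢ˢ Γ' ⇒ Δ
  ⊢ˢ-monoˡ s = ⊢ˢ-antecedent (All-resp-⊇ s)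

  ⊢ˢ-monoʳ : Δ ⊆ Δ' → Θ ⊢ˢ Γ ⇒ Δ → Θ ⊢ˢ Γ ⇒ Δ'
  ⊢ˢ-monoʳ s = ⊢ˢ-succedent (⋁-mono s)

  ⊢ˢ-head : (∀ {Θ'} → Θ' ⊢ ψ → Θ' ⊢ φ) → Θ ⊢ˢ φ ∷ Γ ⇒ Δ → Θ ⊢ˢ ψ ∷ Γ ⇒ Δ
  ⊢ˢ-head f = ⊢ˢ-antecedent λ { (p ∷ ps) → f p ∷ ps }

  ⊢ˢ-last : (∀ {Θ'} → Θ' ⊢ φ → Θ' ⊢ ψ) → Θ ⊢ˢ Γ ⇒ Δ ++ [ φ ] → Θ ⊢ˢ Γ ⇒ Δ ++ [ ψ ]
  ⊢ˢ-last {Δ = Δ} f = ⊢ˢ-succedent λ p →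
    ⋁-++-[]-elim p (λ m → ⋁-hyp (∈-++⁺ˡ m)) (⋁-intro (Δ ++ _) (∈-++⁺ʳ Δ (here refl)) (f hyp₀))

  ⊢ˢ-identity : Θ ⊢ˢ [ φ ] ⇒ [ φ ]
  ⊢ˢ-identity = ⊢ˢ-intro λ { _ (p ∷ []) → ⋁-intro _ (here refl) p }

  ⊢ˢ-⊥ : Θ ⊢ˢ [ ⊥ ] ⇒ [ φ ]
  ⊢ˢ-⊥ = ⊢ˢ-intro λ { _ (p ∷ []) → ⊥E p }

  ⊢ˢ-∧R : Θ ⊢ˢ Γ ⇒ Δ ++ [ φ ] → Θ ⊢ˢ Γ ⇒ Δ ++ [ ψ ] → Θ ⊢ˢ Γ ⇒ Δ ++ [ φ ∧ ψ ]
  ⊢ˢ-∧R {Δ = Δ} p q = ⊢ˢ-intro λ s ps →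
    ⋁-++-[]-elim (⊢ˢ-apply p s ps) inΔ
      (⋁-++-[]-elim (⊢ˢ-apply q (there ∘ s) (All.map (weaken there) ps)) inΔ
        (⋁-intro (Δ ++ _) (∈-++⁺ʳ Δ (here refl)) (∧I hyp₁ hyp₀)))
    where
    inΔ : ∀ {Θ' δ} → δ ∈ Δ → δ ∷ Θ' ⊢ ⋁ (Δ ++ [ φ ∧ ψ ])
    inΔ m = ⋁-hyp (∈-++⁺ˡ m)

  ⊢ˢ-∨L : Θ ⊢ˢ φ ∷ Γ ⇒ Δ → Θ ⊢ˢ ψ ∷ Γ ⇒ Δ → Θ ⊢ˢ φ ∨ ψ ∷ Γ ⇒ Δ
  ⊢ˢ-∨L p q = ⊢ˢ-intro λ { s (r ∷ ps) →
    ∨E r (⊢ˢ-apply p (there ∘ s) (All-assume ps))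
         (⊢ˢ-apply q (there ∘ s) (All-assume ps)) }

  ⊢ˢ-⊃L : Θ ⊢ˢ Γ ⇒ Δ ++ [ φ ] → Θ ⊢ˢ ψ ∷ Γ ⇒ Δ → Θ ⊢ˢ φ ⊃ ψ ∷ Γ ⇒ Δ
  ⊢ˢ-⊃L p q = ⊢ˢ-intro λ { s (r ∷ ps) →
    ⋁-++-[]-elim (⊢ˢ-apply p s ps) ⋁-hyp
      (⊢ˢ-apply q (there ∘ s) (⊃E (weaken there r) hyp₀ ∷ All.map (weaken there) ps)) }

  ⊢ˢ-⊃R : Θ ⊢ˢ φ ∷ Γ ⇒ [ ψ ] → Θ ⊢ˢ Γ ⇒ [ φ ⊃ ψ ]
  ⊢ˢ-⊃R {ψ = ψ} p = ⊢ˢ-intro λ s ps → ⋁-intro _ (here refl)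
    (⊃I (subst (_ ⊢_) (⋁-singleton ψ) (⊢ˢ-apply p (there ∘ s) (All-assume ps))))

  ⊢ˢ-cut : Θ ⊢ˢ Γ ⇒ Δ ++ [ φ ] → Θ ⊢ˢ φ ∷ Γ' ⇒ Δ' → Θ ⊢ˢ Γ ++ Γ' ⇒ Δ ++ Δ'
  ⊢ˢ-cut {Γ = Γ} {Δ = Δ} {Δ' = Δ'} p q = ⊢ˢ-intro λ s ps →
    ⋁-++-[]-elim (⊢ˢ-apply p s (All.++⁻ˡ Γ ps)) (λ m → ⋁-hyp (∈-++⁺ˡ m))
      (⋁-mono (xs⊆ys++xs Δ' Δ)
        (⊢ˢ-apply q (there ∘ s) (All-assume (All.++⁻ʳ Γ ps))))

  ⊢ˢ-absorb : Θ ⊢ ⋀ Γ ⊃ ⋀ Γ' → Θ ⊢ˢ Γ ++ Γ' ⇒ Δ → Θ ⊢ˢ Γ ⇒ Δ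
  ⊢ˢ-absorb {Γ = Γ} {Γ' = Γ'} i p = ⊢ˢ-intro λ s ps →
    ⊢ˢ-apply p s (All.++⁺ ps (⋀-elim Γ' (⊃E (weaken s i) (⋀-intro Γ ps))))

  ⊢ˢ-ls : Θ ⊢ˢ Γ₁ ++ Γ₂ ⇒ Δ → Θ ⊢ ⟦ Γ₁ ⇒ Δ ⟧ˢ ∨ ⟦ Γ₂ ⇒ Δ ⟧ˢ
  ⊢ˢ-ls {Γ₁ = Γ₁} {Γ₂ = Γ₂} p = ∨E lin
    (∨I₁ (derivationˢ (⊢ˢ-absorb hyp₀ (⊢ˢ-weaken there p))))
    (∨I₂ (derivationˢ (⊢ˢ-absorb hyp₀ (⊢ˢ-monoˡ swapped (⊢ˢ-weaken there p)))))
    where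
    swapped : Γ₁ ++ Γ₂ ⊆ Γ₂ ++ Γ₁
    swapped = ⊆-reflexive-↭ (Perm.++-comm Γ₁ Γ₂)

  ⊢ʰ-head : [] ⊢ˢ S → ⊢ʰ S ∷ G
  ⊢ʰ-head (sequent p) = hypersequent (⋁-intro _ (here refl) p)

  ⊢ʰ-mono : H ⊆ H' → ⊢ʰ H → ⊢ʰ H'
  ⊢ʰ-mono s (hypersequent p) = hypersequent (⋁-mono (map⁺ ⟦_⟧ˢ s) p)

  ⊢ʰ-∷⁺ : [] ⊢ ⟦ S ⟧ˢ ∨ ⟦ G ⟧ʰ → ⊢ʰ S ∷ G
  ⊢ʰ-∷⁺ p = hypersequent (⋁-∷⁺ p)

  ⊢ʰ-∷⁻ : ⊢ʰ S ∷ G → [] ⊢ ⟦ S ⟧ˢ ∨ ⟦ G ⟧ʰ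
  ⊢ʰ-∷⁻ (hypersequent p) = ⋁-∷⁻ p

  ⊢ʰ-map : (∀ {Θ} → Θ ⊢ˢ S → Θ ⊢ˢ T) → ⊢ʰ S ∷ G → ⊢ʰ T ∷ G
  ⊢ʰ-map f d = ⊢ʰ-∷⁺ (∨E (⊢ʰ-∷⁻ d) (∨I₁ (derivationˢ (f (sequent hyp₀)))) (∨I₂ hyp₀))

  ⊢ʰ-map₂ : (∀ {Θ} → Θ ⊢ˢ S₁ → Θ ⊢ˢ S₂ → Θ ⊢ˢ T) → ⊢ʰ S₁ ∷ G → ⊢ʰ S₂ ∷ G → ⊢ʰ T ∷ G
  ⊢ʰ-map₂ f d e = ⊢ʰ-∷⁺ (∨E (⊢ʰ-∷⁻ d)
    (∨E (weaken there (⊢ʰ-∷⁻ e)) (∨I₁ (derivationˢ (f (sequent hyp₁) (sequent hyp₀)))) (∨I₂ hyp₀))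
    (∨I₂ hyp₀))

  ⊢ʰ-ls : ⊢ʰ (Γ₁ ++ Γ₂ ⇒ Δ) ∷ G → ⊢ʰ (Γ₁ ⇒ Δ) ∷ (Γ₂ ⇒ Δ) ∷ G
  ⊢ʰ-ls d = ⊢ʰ-∷⁺ (∨E (⊢ʰ-∷⁻ d)
    (∨E (⊢ˢ-ls (sequent hyp₀)) (∨I₁ hyp₀) (∨I₂ (⋁-∷⁺ (∨I₁ hyp₀))))
    (∨I₂ (⋁-∷⁺ (∨I₂ hyp₀))))

open Defs

⊢GD-assumption : ∀ {Θ φ} → φ ∈ Θ → Θ ⊢GD φ
⊢GD-assumption m with ∈-∃++ m
... | Γ , Γ' , refl = hyp {Γ} {Γ'}

⊢GD-weaken : ∀ {Θ Θ' φ} → Θ ⊆ Θ' → Θ ⊢GD φ → Θ' ⊢GD φ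
⊢GD-weaken s (hyp {Γ}) = ⊢GD-assumption (s (∈-insert Γ))
⊢GD-weaken s (⊥E p)     = ⊥E (⊢GD-weaken s p)
⊢GD-weaken s (∧I p q)   = ∧I (⊢GD-weaken s p) (⊢GD-weaken s q)
⊢GD-weaken s (∧E₁ p)    = ∧E₁ (⊢GD-weaken s p)
⊢GD-weaken s (∧E₂ p)    = ∧E₂ (⊢GD-weaken s p)
⊢GD-weaken s (∨I₁ p)    = ∨I₁ (⊢GD-weaken s p)
⊢GD-weaken s (∨I₂ p)    = ∨I₂ (⊢GD-weaken s p)
⊢GD-weaken s (∨E p q r) = ∨E (⊢GD-weaken s p) (⊢GD-weaken (∷⁺ʳ _ s) q) (⊢GD-weaken (∷⁺ʳ _ s) r)
⊢GD-weaken s (⊃I p)     = ⊃I (⊢GD-weaken (∷⁺ʳ _ s) p)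
⊢GD-weaken s (⊃E p q)   = ⊃E (⊢GD-weaken s p) (⊢GD-weaken s q)
⊢GD-weaken s lin        = lin

GD : GödelDummettCalculus
GD = record
  { Formula = PFm ; ⊥ = ⊥ ; _∧_ = _∧_ ; _∨_ = _∨_ ; _⊃_ = _⊃_ ; ⋀ = ⋀ ; ⋁ = ⋁
  ; ⋀-nil = refl ; ⋀-singleton = λ _ → refl ; ⋀-cons = λ _ _ _ → refl
  ; ⋁-nil = refl ; ⋁-singleton = λ _ → refl ; ⋁-cons = λ _ _ _ → refl
  ; _⊢_ = _⊢GD_ ; weaken = ⊢GD-weaken ; assumption = ⊢GD-assumption
  ; ⊥E = ⊥E ; ∧I = ∧I ; ∧E₁ = ∧E₁ ; ∧E₂ = ∧E₂ ; ∨I₁ = ∨I₁ ; ∨I₂ = ∨I₂ ; ∨E = ∨E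
  ; ⊃I = ⊃I ; ⊃E = ⊃E ; lin = lin
  }

module Propositional where
  open Soundness GD

  ⊢ʰ-sound : ∀ {H} → HLJ'ls H → ⊢ʰ H
  ⊢ʰ-sound ax          = ⊢ʰ-head ⊢ˢ-identity
  ⊢ʰ-sound ax⊥         = ⊢ʰ-head ⊢ˢ-⊥
  ⊢ʰ-sound (ew d)      = ⊢ʰ-mono there (⊢ʰ-sound d)
  ⊢ʰ-sound (ec d)      = ⊢ʰ-mono ∷∷⊆∷ (⊢ʰ-sound d)
  ⊢ʰ-sound (ee {G} d)  = ⊢ʰ-mono (swap⊆ G) (⊢ʰ-sound d)
  ⊢ʰ-sound (iwl d)     = ⊢ʰ-map (⊢ˢ-monoˡ there) (⊢ʰ-sound d)
  ⊢ʰ-sound (iwr d)     = ⊢ʰ-map (⊢ˢ-monoʳ (∈-++⁺ˡ)) (⊢ʰ-sound d)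
  ⊢ʰ-sound (icl d)     = ⊢ʰ-map (⊢ˢ-monoˡ ∷∷⊆∷) (⊢ʰ-sound d)
  ⊢ʰ-sound (icr {Δ = Δ} d) = ⊢ʰ-map (⊢ˢ-monoʳ (++⁺ʳ Δ ∷∷⊆∷)) (⊢ʰ-sound d)
  ⊢ʰ-sound (iel {Γ = Γ} d) = ⊢ʰ-map (⊢ˢ-monoˡ (swap⊆ Γ)) (⊢ʰ-sound d)
  ⊢ʰ-sound (ier {Δ = Δ} d) = ⊢ʰ-map (⊢ˢ-monoʳ (swap⊆ Δ)) (⊢ʰ-sound d)
  ⊢ʰ-sound (cut d e)   = ⊢ʰ-map₂ ⊢ˢ-cut (⊢ʰ-sound d) (⊢ʰ-sound e)
  ⊢ʰ-sound (∧L₁ d)     = ⊢ʰ-map (⊢ˢ-head ∧E₁) (⊢ʰ-sound d)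
  ⊢ʰ-sound (∧L₂ d)     = ⊢ʰ-map (⊢ˢ-head ∧E₂) (⊢ʰ-sound d)
  ⊢ʰ-sound (∧R d e)    = ⊢ʰ-map₂ ⊢ˢ-∧R (⊢ʰ-sound d) (⊢ʰ-sound e)
  ⊢ʰ-sound (∨L d e)    = ⊢ʰ-map₂ ⊢ˢ-∨L (⊢ʰ-sound d) (⊢ʰ-sound e)
  ⊢ʰ-sound (∨R₁ d)     = ⊢ʰ-map (⊢ˢ-last ∨I₁) (⊢ʰ-sound d)
  ⊢ʰ-sound (∨R₂ d)     = ⊢ʰ-map (⊢ˢ-last ∨I₂) (⊢ʰ-sound d)
  ⊢ʰ-sound (⊃L d e)    = ⊢ʰ-map₂ ⊢ˢ-⊃L (⊢ʰ-sound d) (⊢ʰ-sound e)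
  ⊢ʰ-sound (⊃R' d)     = ⊢ʰ-map ⊢ˢ-⊃R (⊢ʰ-sound d)
  ⊢ʰ-sound (ls d)      = ⊢ʰ-ls (⊢ʰ-sound d)

  soundness : ∀ H → HLJ'ls H → GD-valid (interp H)
  soundness H d = derivationʰ (⊢ʰ-sound d)

⊢∀GD-assumption : ∀ {Θ φ} → φ ∈ Θ → Θ ⊢∀GD φ
⊢∀GD-assumption m with ∈-∃++ m
... | Γ , Γ' , refl = hyp {Γ} {Γ'}

⊢∀GD-weaken : ∀ {Θ Θ' φ} → Θ ⊆ Θ' → Θ ⊢∀GD φ → Θ' ⊢∀GD φ
⊢∀GD-weaken s (hyp {Γ}) = ⊢∀GD-assumption (s (∈-insert Γ))
⊢∀GD-weaken s (⊥E p)     = ⊥E (⊢∀GD-weaken s p)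
⊢∀GD-weaken s (∧I p q)   = ∧I (⊢∀GD-weaken s p) (⊢∀GD-weaken s q)
⊢∀GD-weaken s (∧E₁ p)    = ∧E₁ (⊢∀GD-weaken s p)
⊢∀GD-weaken s (∧E₂ p)    = ∧E₂ (⊢∀GD-weaken s p)
⊢∀GD-weaken s (∨I₁ p)    = ∨I₁ (⊢∀GD-weaken s p)
⊢∀GD-weaken s (∨I₂ p)    = ∨I₂ (⊢∀GD-weaken s p)
⊢∀GD-weaken s (∨E p q r) = ∨E (⊢∀GD-weaken s p) (⊢∀GD-weaken (∷⁺ʳ _ s) q) (⊢∀GD-weaken (∷⁺ʳ _ s) r)
⊢∀GD-weaken s (⊃I p)     = ⊃I (⊢∀GD-weaken (∷⁺ʳ _ s) p)
⊢∀GD-weaken s (⊃E p q)   = ⊃E (⊢∀GD-weaken s p) (⊢∀GD-weaken s q)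
⊢∀GD-weaken s (∀I p)     = ∀I (⊢∀GD-weaken (map⁺ ↑ s) p)
⊢∀GD-weaken s (∀E t p)   = ∀E t (⊢∀GD-weaken s p)
⊢∀GD-weaken s (∃I t p)   = ∃I t (⊢∀GD-weaken s p)
⊢∀GD-weaken s (∃E p q)   = ∃E (⊢∀GD-weaken s p) (⊢∀GD-weaken (∷⁺ʳ _ (map⁺ ↑ s)) q)
⊢∀GD-weaken s lin        = lin
⊢∀GD-weaken s acd        = acd

∀GD : GödelDummettCalculus
∀GD = record
  { Formula = Fm ; ⊥ = ⊥ ; _∧_ = _∧_ ; _∨_ = _∨_ ; _⊃_ = _⊃_ ; ⋀ = ⋀F ; ⋁ = ⋁F
  ; ⋀-nil = refl ; ⋀-singleton = λ _ → refl ; ⋀-cons = λ _ _ _ → refl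
  ; ⋁-nil = refl ; ⋁-singleton = λ _ → refl ; ⋁-cons = λ _ _ _ → refl
  ; _⊢_ = _⊢∀GD_ ; weaken = ⊢∀GD-weaken ; assumption = ⊢∀GD-assumption
  ; ⊥E = ⊥E ; ∧I = ∧I ; ∧E₁ = ∧E₁ ; ∧E₂ = ∧E₂ ; ∨I₁ = ∨I₁ ; ∨I₂ = ∨I₂ ; ∨E = ∨E
  ; ⊃I = ⊃I ; ⊃E = ⊃E ; lin = lin
  }

module _ {σ : ℕ → Term} {ρ : ℕ → ℕ} where

  mutual
    subT-renT-cancel : (∀ n → σ (ρ n) ≡ var n) → ∀ t → subT σ (renT ρ t) ≡ t
    subT-renT-cancel σρ (var n)   = σρ n
    subT-renT-cancel σρ (fn f ts) = cong (fn f) (subTs-renTs-cancel σρ ts)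

    subTs-renTs-cancel : (∀ n → σ (ρ n) ≡ var n) → ∀ ts → subTs σ (renTs ρ ts) ≡ ts
    subTs-renTs-cancel σρ []       = refl
    subTs-renTs-cancel σρ (t ∷ ts) = cong₂ _∷_ (subT-renT-cancel σρ t) (subTs-renTs-cancel σρ ts)

  liftS-liftR-cancel : (∀ n → σ (ρ n) ≡ var n) → ∀ n → liftS σ (liftR ρ n) ≡ var n
  liftS-liftR-cancel σρ zero    = refl
  liftS-liftR-cancel σρ (suc n) = cong (renT suc) (σρ n)

sub-ren-cancel : ∀ {σ ρ} → (∀ n → σ (ρ n) ≡ var n) → ∀ φ → sub σ (ren ρ φ) ≡ φ
sub-ren-cancel σρ (atom p ts) = cong (atom p) (subTs-renTs-cancel σρ ts)
sub-ren-cancel σρ ⊥           = refl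
sub-ren-cancel σρ (φ ∧ ψ)     = cong₂ _∧_ (sub-ren-cancel σρ φ) (sub-ren-cancel σρ ψ)
sub-ren-cancel σρ (φ ∨ ψ)     = cong₂ _∨_ (sub-ren-cancel σρ φ) (sub-ren-cancel σρ ψ)
sub-ren-cancel σρ (φ ⊃ ψ)     = cong₂ _⊃_ (sub-ren-cancel σρ φ) (sub-ren-cancel σρ ψ)
sub-ren-cancel σρ (∀̇ φ)       = cong ∀̇ (sub-ren-cancel (liftS-liftR-cancel σρ) φ)
sub-ren-cancel σρ (∃̇ φ)       = cong ∃̇ (sub-ren-cancel (liftS-liftR-cancel σρ) φ)

ren-liftR-suc-⟨var0⟩ : ∀ φ → ren (liftR suc) φ ⟨ var 0 ⟩ ≡ φ
ren-liftR-suc-⟨var0⟩ = sub-ren-cancel λ { zero → refl ; (suc n) → refl }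

↑-⋀F : ∀ Γ → ↑ (⋀F Γ) ≡ ⋀F (↑* Γ)
↑-⋀F []          = refl
↑-⋀F (φ ∷ [])    = refl
↑-⋀F (φ ∷ ψ ∷ Γ) = cong (↑ φ ∧_) (↑-⋀F (ψ ∷ Γ))

↑-⋁F : ∀ Δ → ↑ (⋁F Δ) ≡ ⋁F (↑* Δ)
↑-⋁F []          = refl
↑-⋁F (φ ∷ [])    = refl
↑-⋁F (φ ∷ ψ ∷ Δ) = cong (↑ φ ∨_) (↑-⋁F (ψ ∷ Δ))

∀ⁿ-intro : ∀ {φ} k → [] ⊢∀GD φ → [] ⊢∀GD ∀ⁿ k φ
∀ⁿ-intro zero    p = p
∀ⁿ-intro (suc k) p = ∀I (∀ⁿ-intro k p)

module FirstOrder where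
  open Soundness ∀GD

  ↑-⟦⟧ʰ : ∀ G → ↑ ⟦ G ⟧ʰ ≡ ⟦ ↑H G ⟧ʰ
  ↑-⟦⟧ʰ G = begin
      ↑ (⋁F (map ⟦_⟧ˢ G))      ≡⟨ ↑-⋁F (map ⟦_⟧ˢ G) ⟩
      ⋁F (↑* (map ⟦_⟧ˢ G))     ≡⟨ cong ⋁F (↑*-⟦⟧ˢ G) ⟩
      ⋁F (map ⟦_⟧ˢ (↑H G))     ∎
    where
    open ≡-Reasoning
    ↑*-⟦⟧ˢ : ∀ G → ↑* (map ⟦_⟧ˢ G) ≡ map ⟦_⟧ˢ (↑H G)
    ↑*-⟦⟧ˢ []             = refl
    ↑*-⟦⟧ˢ ((Γ ⇒ Δ) ∷ G) = cong₂ _∷_ (cong₂ _⊃_ (↑-⋀F Γ) (↑-⋁F Δ)) (↑*-⟦⟧ˢ G)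

  ∀̇⊃-vacuous : ∀ {Θ φ ψ} → ∀̇ (↑ ψ ⊃ φ) ∷ Θ ⊢∀GD ψ ⊃ ∀̇ φ
  ∀̇⊃-vacuous {Θ} {φ} {ψ} = ⊃I (∀I (⊃E instance₀ hyp₀))
    where
    instance₀ : ↑ ψ ∷ ↑ (∀̇ (↑ ψ ⊃ φ)) ∷ ↑* Θ ⊢∀GD ↑ ψ ⊃ φ
    instance₀ = subst (↑ ψ ∷ ↑ (∀̇ (↑ ψ ⊃ φ)) ∷ ↑* Θ ⊢∀GD_) (ren-liftR-suc-⟨var0⟩ (↑ ψ ⊃ φ)) (∀E (var 0) hyp₁)

  ⊢ʰ-∀Rms : ∀ {Γ φ G} → ⊢ʰ (↑* Γ ⇒ [ φ ]) ∷ ↑H G → ⊢ʰ (Γ ⇒ [ ∀̇ φ ]) ∷ G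
  ⊢ʰ-∀Rms {Γ} {φ} {G} d = ⊢ʰ-∷⁺ (∨E (⊃E acd (∀I shifted)) (∨I₂ hyp₀) (∨I₁ ∀̇⊃-vacuous))
    where
    shifted : [] ⊢∀GD ↑ ⟦ G ⟧ʰ ∨ (↑ (⋀F Γ) ⊃ φ)
    shifted = ∨E (⊢ʰ-∷⁻ d)
      (∨I₂ (subst (λ γ → [ ⋀F (↑* Γ) ⊃ φ ] ⊢∀GD γ ⊃ φ) (sym (↑-⋀F Γ)) hyp₀))
      (∨I₁ (subst ([ ⟦ ↑H G ⟧ʰ ] ⊢∀GD_) (sym (↑-⟦⟧ʰ G)) hyp₀))

  ⊢ʰ-∃L : ∀ {φ Γ Δ} → ⊢ʰ (φ ∷ ↑* Γ ⇒ ↑* Δ) ∷ [] → ⊢ʰ (∃̇ φ ∷ Γ ⇒ Δ) ∷ []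
  ⊢ʰ-∃L {φ} {Γ} {Δ} (hypersequent p) = hypersequent (⊃I (∃E witness body))
    where
    Φ = ∃̇ φ ∷ Γ
    witness : [ ⋀F Φ ] ⊢∀GD ∃̇ φ
    witness = All.head (⋀-elim Φ hyp₀)
    premise : [] ⊢ˢ φ ∷ ↑* Γ ⇒ ↑* Δ
    premise = sequent p
    shifted-Φ : All (φ ∷ ↑* [ ⋀F Φ ] ⊢∀GD_) (↑* Φ)
    shifted-Φ = ⋀-elim (↑* Φ) (subst (φ ∷ ↑* [ ⋀F Φ ] ⊢∀GD_) (↑-⋀F Φ) hyp₁)
    body : φ ∷ ↑* [ ⋀F Φ ] ⊢∀GD ↑ (⋁F Δ)
    body = subst (φ ∷ ↑* [ ⋀F Φ ] ⊢∀GD_) (sym (↑-⋁F Δ)) (⊢ˢ-apply premise (λ ()) (hyp₀ ∷ All.tail shifted-Φ))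

  ⊢ʰ-sound : ∀ {H} → ∀HLJ'ms H → ⊢ʰ H
  ⊢ʰ-sound ax          = ⊢ʰ-head ⊢ˢ-identity
  ⊢ʰ-sound ax⊥         = ⊢ʰ-head ⊢ˢ-⊥
  ⊢ʰ-sound (ew d)      = ⊢ʰ-mono there (⊢ʰ-sound d)
  ⊢ʰ-sound (ec d)      = ⊢ʰ-mono ∷∷⊆∷ (⊢ʰ-sound d)
  ⊢ʰ-sound (ee {G} d)  = ⊢ʰ-mono (swap⊆ G) (⊢ʰ-sound d)
  ⊢ʰ-sound (iwl d)     = ⊢ʰ-map (⊢ˢ-monoˡ there) (⊢ʰ-sound d)
  ⊢ʰ-sound (iwr d)     = ⊢ʰ-map (⊢ˢ-monoʳ ∈-++⁺ˡ) (⊢ʰ-sound d)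
  ⊢ʰ-sound (icl d)     = ⊢ʰ-map (⊢ˢ-monoˡ ∷∷⊆∷) (⊢ʰ-sound d)
  ⊢ʰ-sound (icr {Δ = Δ} d) = ⊢ʰ-map (⊢ˢ-monoʳ (++⁺ʳ Δ ∷∷⊆∷)) (⊢ʰ-sound d)
  ⊢ʰ-sound (iel {Γ = Γ} d) = ⊢ʰ-map (⊢ˢ-monoˡ (swap⊆ Γ)) (⊢ʰ-sound d)
  ⊢ʰ-sound (ier {Δ = Δ} d) = ⊢ʰ-map (⊢ˢ-monoʳ (swap⊆ Δ)) (⊢ʰ-sound d)
  ⊢ʰ-sound (cut d e)   = ⊢ʰ-map₂ ⊢ˢ-cut (⊢ʰ-sound d) (⊢ʰ-sound e)
  ⊢ʰ-sound (∧L₁ d)     = ⊢ʰ-map (⊢ˢ-head ∧E₁) (⊢ʰ-sound d)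
  ⊢ʰ-sound (∧L₂ d)     = ⊢ʰ-map (⊢ˢ-head ∧E₂) (⊢ʰ-sound d)
  ⊢ʰ-sound (∧R d e)    = ⊢ʰ-map₂ ⊢ˢ-∧R (⊢ʰ-sound d) (⊢ʰ-sound e)
  ⊢ʰ-sound (∨L d e)    = ⊢ʰ-map₂ ⊢ˢ-∨L (⊢ʰ-sound d) (⊢ʰ-sound e)
  ⊢ʰ-sound (∨R₁ d)     = ⊢ʰ-map (⊢ˢ-last ∨I₁) (⊢ʰ-sound d)
  ⊢ʰ-sound (∨R₂ d)     = ⊢ʰ-map (⊢ˢ-last ∨I₂) (⊢ʰ-sound d)
  ⊢ʰ-sound (⊃L d e)    = ⊢ʰ-map₂ ⊢ˢ-⊃L (⊢ʰ-sound d) (⊢ʰ-sound e)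
  ⊢ʰ-sound (⊃R' d)     = ⊢ʰ-map ⊢ˢ-⊃R (⊢ʰ-sound d)
  ⊢ʰ-sound (∀L {t = t} d) = ⊢ʰ-map (⊢ˢ-head (∀E t)) (⊢ʰ-sound d)
  ⊢ʰ-sound (∃R {t = t} d) = ⊢ʰ-map (⊢ˢ-last (∃I t)) (⊢ʰ-sound d)
  ⊢ʰ-sound (∀R d)      = ⊢ʰ-∀Rms (⊢ʰ-sound d)
  ⊢ʰ-sound (∀Rms d)    = ⊢ʰ-∀Rms (⊢ʰ-sound d)
  ⊢ʰ-sound (∃L d)      = ⊢ʰ-∃L (⊢ʰ-sound d)
  ⊢ʰ-sound (ls d)      = ⊢ʰ-ls (⊢ʰ-sound d)

  soundness : ∀ H → ∀HLJ'ms H → ∀GD-valid (closure (interpF H))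
  soundness H d = ∀ⁿ-intro (fv (interpF H)) (derivationʰ (⊢ʰ-sound d))

mainTheorem5 : (∀ (H : HSeq PFm) → HLJ'ls H → GD-valid (interp H))
             × (∀ (H : HSeq Fm) → ∀HLJ'ms H → ∀GD-valid (closure (interpF H)))
mainTheorem5 = Propositional.soundness , FirstOrder.soundness
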